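{- Let $n\ge 0$, let $\mathbf{k}$ be a commutative ring and $\mathcal{A}=\mathbf{k}[S_n]$. If $\beta,\gamma$ are compositions of $n$ such that $\beta$ refines $\gamma$, then $\mathbf{B}_\beta\mathcal{A}\subseteq\mathbf{B}_\gamma\mathcal{A}$.
   Context: $S_n$ is the symmetric group on $[n]$. For $w\in S_n$, $\operatorname{Des}(w)=\{i\in[n-1]\mid w(i)>w(i+1)\}$. A composition $\alpha=(\alpha_1,\dots,\alpha_p)$ of $n$ is a finite sequence of positive integers with sum $n$; $\operatorname{Set}(\alpha)=\{\alpha_1,\alpha_1+\alpha_2,\dots,\alpha_1+\cdots+\alpha_{p-1}\}\subseteq[n-1]$ and $\mathbf{B}_\alpha=\sum_{w\in S_n,\ \operatorname{Des}(w)\subseteq\operatorname{Set}(\alpha)}w$. A composition $\alpha=(\alpha_1,\dots,\alpha_m)$ refines $\beta=(\beta_1,\dots,\beta_p)$ (both of $n$) if $\alpha$ can be cut into $p$ contiguous subsequences $\alpha^{(1)},\dots,\alpha^{(p)}$ with the entries of $\alpha^{(j)}$ summing to $\beta_j$ for all $j$. -}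

module Defs where

open import Level using (Level)
open import Data.Bool using (Bool; true; false; _∧_; _∨_; if_then_else_; T)
open import Data.Nat as ℕ using (ℕ; zero; suc; _<_; _<ᵇ_; _≡ᵇ_)
open import Data.Nat.ListAction using (sum)
open import Data.Fin as Fin using (Fin; toℕ)
open import Data.Product using (Σ; _×_; _,_; proj₁; proj₂; ∃)
open import Data.List as List using (List; []; _∷_; map; concatMap; allFin; filterᵇ; concat; _++_; foldr)
open import Data.List.Relation.Unary.All using (All)
open import Data.Vec as Vec using (Vec; lookup; tabulate; toList)
import Data.Vec.Properties as VecP
open import Relation.Nullary using (does)
open import Relation.Binary.PropositionalEquality using (_≡_)
open import Algebra.Bundles using (CommutativeRing)

IsComposition : ℕ → List ℕ → Set
IsComposition n α = All (λ a → 0 < a) α × sum α ≡ n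

-- Set(α) = {α₁, α₁+α₂, …, α₁+⋯+α_{p-1}}  (as a list)
setOf : List ℕ → List ℕ
setOf []           = []
setOf (a ∷ [])     = []
setOf (a ∷ b ∷ r)  = a ∷ map (a ℕ.+_) (setOf (b ∷ r))

Refines : List ℕ → List ℕ → Set
Refines α β = Σ (List (List ℕ)) λ pieces → (concat pieces ≡ α) × (map sum pieces ≡ β)

-- Permutations in one-line notation: w ↦ (w(1),…,w(n)), 0-based values.

Word : ℕ → Set
Word n = Vec (Fin n) n

memᵇ : ℕ → List ℕ → Bool
memᵇ x []       = false
memᵇ x (y ∷ ys) = (x ≡ᵇ y) ∨ memᵇ x ys

allᵇ : {A : Set} → (A → Bool) → List A → Bool
allᵇ p = foldr (λ x b → p x ∧ b) true

distinctᵇ : List ℕ → Bool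
distinctᵇ []       = true
distinctᵇ (x ∷ xs) = (if memᵇ x xs then false else true) ∧ distinctᵇ xs

isPermᵇ : ∀ {n} → Word n → Bool
isPermᵇ w = distinctᵇ (map toℕ (toList w))

IsPerm : ∀ {n} → Word n → Set
IsPerm w = T (isPermᵇ w)

allVecs : (k m : ℕ) → List (Vec (Fin m) k)
allVecs zero    m = Vec.[] ∷ []
allVecs (suc k) m = concatMap (λ i → map (i Vec.∷_) (allVecs k m)) (allFin m)

Sn : (n : ℕ) → List (Word n)
Sn n = filterᵇ isPermᵇ (allVecs n n)

-- descent set (1-based positions i with w(i) > w(i+1)) of a list of values
desAux : ℕ → List ℕ → List ℕ
desAux i []           = []
desAux i (x ∷ [])     = []
desAux i (x ∷ y ∷ r)  = (if y <ᵇ x then i ∷ [] else []) ++ desAux (suc i) (y ∷ r)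

Des : ∀ {n} → Word n → List ℕ
Des w = desAux 1 (map toℕ (toList w))

desInSetᵇ : ∀ {n} → List ℕ → Word n → Bool
desInSetᵇ α w = allᵇ (λ d → memᵇ d (setOf α)) (Des w)

module GroupAlgebra {c ℓ : Level} (R : CommutativeRing c ℓ) (n : ℕ) where
  open CommutativeRing R

  -- formal linear combination of words
  Elt : Set c
  Elt = List (Carrier × Word n)

  InA : Elt → Set c
  InA x = All (λ t → IsPerm (proj₂ t)) x

  compose : Word n → Word n → Word n
  compose w v = tabulate (λ i → lookup w (lookup v i))

  _·_ : Elt → Elt → Elt
  x · y = concatMap (λ s → map (λ t → (proj₁ s * proj₁ t , compose (proj₂ s) (proj₂ t))) y) x

  coeff : Word n → Elt → Carrier
  coeff u x = foldr (λ t acc → (if does (VecP.≡-dec Fin._≟_ (proj₂ t) u) then proj₁ t else 0#) + acc) 0# x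

  _≈A_ : Elt → Elt → Set ℓ
  x ≈A y = ∀ u → coeff u x ≈ coeff u y

  B : List ℕ → Elt
  B α = map (λ w → (1# , w)) (filterᵇ (desInSetᵇ α) (Sn n))

  InBA : List ℕ → Elt → Set (c Level.⊔ ℓ)
  InBA α x = Σ Elt λ a → InA a × (x ≈A (B α · a))

{-# OPTIONS --safe #-}
module Submission where

-- Write X_α for the permutations with descents in Set(α), so that B_α = Σ_{w ∈ X_α} w.
-- If β refines γ then Set(γ) ⊆ Set(β), and every w ∈ X_β factors uniquely as w = x y with
-- x ∈ X_γ and y ∈ X_β mapping every block of γ onto itself (a parabolic factorization:
-- x is increasing on the blocks of γ and y sorts w inside them). Hence B_β = B_γ D with
-- D = Σ y, and B_β a = B_γ (D a).
-- The factorization exists by bubble sort inside the blocks: swapping an adjacent descent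
-- that is not a cut of γ strictly increases Σ_k k·w(k). It is unique because y is then an
-- order embedding into Fin n of the positions ordered by block and then by the value of w,
-- and such an embedding is unique.

open import Defs

open import Algebra.Bundles using (CommutativeRing)
import Algebra.Properties.CommutativeSemigroup as CommutativeSemigroupProperties
open import Data.Bool using (Bool; true; false; T; if_then_else_; _∧_)
open import Data.Bool.Properties using (T?; T-∧)
open import Data.Fin as Fin using (Fin; toℕ; _<_; _≤_; inject₁; punchOut; fromℕ<)
open import Data.Fin.Patterns using (0F)
open import Data.Fin.Permutation.Components using (transpose; transpose-inverse)
open import Data.Fin.Properties
  using ( suc-injective; toℕ-injective; toℕ<n; toℕ-inject₁; toℕ-fromℕ<; ≤̄⇒inject₁<; _≟_; any?; all?
        ; injective⇒≤; punchOut-injective; <-cmp; <⇒≢; <-asym; <-trans; ≤-antisym)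
open import Data.List as List
  using ( List; []; _∷_; map; _++_; concat; concatMap; cartesianProductWith; cartesianProduct
        ; allFin; filter; filterᵇ)
import Data.List.Properties as List
open import Data.List.Membership.Propositional using (_∈_)
open import Data.List.Membership.Propositional.Properties
  using (∈-map⁺; ∈-map⁻; ∈-filter⁺; ∈-filter⁻; ∈-allFin; ∈-cartesianProductWith⁺; ∈-cartesianProduct⁺; ∈-cartesianProduct⁻)
open import Data.List.Membership.Propositional.Properties.WithK using (unique∧set⇒bag)
open import Data.List.Relation.Binary.BagAndSetEquality using (∼bag⇒↭)
open import Data.List.Relation.Binary.Permutation.Propositional as ↭ using (_↭_)
import Data.List.Relation.Binary.Permutation.Propositional.Properties as ↭
open import Data.List.Relation.Unary.All as All using (All)
import Data.List.Relation.Unary.All.Properties as Allₚ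
open import Data.List.Relation.Unary.Any using (here; there)
open import Data.List.Relation.Unary.AllPairs as AllPairs using ()
open import Data.List.Relation.Unary.Unique.Propositional using (Unique)
import Data.List.Relation.Unary.Unique.Propositional.Properties as Uniqueₚ
open import Data.Nat as ℕ using (ℕ; zero; suc; z≤n; _+_; _*_; _≡ᵇ_; _<ᵇ_)
open import Data.Nat.Induction using (<-wellFounded)
open import Data.Nat.ListAction using (sum)
import Data.Nat.Properties as ℕ
open import Data.Nat.Tactic.RingSolver using (solve-∀)
open import Data.Product using (∃; ∃₂; _×_; _,_; proj₁; proj₂; uncurry)
open import Data.Product.Relation.Binary.Pointwise.NonDependent using (×-setoid)
open import Data.Sum using (_⊎_; inj₁; inj₂)
open import Data.Unit using (tt)
open import Data.Vec as Vec using (Vec; lookup; toList; tabulate)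
import Data.Vec.Properties as Vec
open import Data.Vec.Functional using (updateAt)
open import Data.Vec.Functional.Properties using (updateAt-updates; updateAt-minimal)
open import Data.Vec.Membership.Propositional.Properties using (∈-lookup; ∈-toList⁺)
open import Function using (_∘_; id)
open import Function.Bundles using (mk⇔; Equivalence)
open import Function.Definitions using (Injective)
open import Induction.WellFounded using (Acc; acc)
open import Level using (Level)
open import Relation.Binary.Bundles using (Setoid)
open import Relation.Binary.Core using (Rel; _Preserves_⟶_)
open import Relation.Binary.Definitions using (tri<; tri≈; tri>)
open import Relation.Binary.PropositionalEquality as ≡
  using (_≡_; _≢_; _≗_; refl; sym; trans; cong; cong₂; subst; subst₂; module ≡-Reasoning)
open import Relation.Nullary using (¬_; Dec; yes; no; contradiction)
open import Relation.Nullary.Decidable using (decidable-stable; ¬?; _×-dec_)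
open import Algebra.Properties.Monoid.Sum ℕ.+-0-monoid using (sum-cong-≗) renaming (sum to ∑)
open CommutativeSemigroupProperties ℕ.+-commutativeSemigroup using (xy∙z≈xz∙y; xy∙z≈zy∙x)

-- Order embeddings of Fin n

injective⇒surjective : ∀ {n} {f : Fin n → Fin n} → Injective _≡_ _≡_ f → ∀ a → ∃ λ i → f i ≡ a
injective⇒surjective {suc m} {f} f-injective a with any? (λ i → f i ≟ a)
... | yes found = found
... | no ∄ = contradiction (injective⇒≤ punchOut∘f-injective) (ℕ.n≮n m)
  where
  a≢f : ∀ i → a ≢ f i
  a≢f i a≡fi = ∄ (i , sym a≡fi)
  punchOut∘f-injective : Injective _≡_ _≡_ (λ i → punchOut (a≢f i))
  punchOut∘f-injective eq = f-injective (punchOut-injective (a≢f _) (a≢f _) eq)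

module Inverse {n} {f : Fin n → Fin n} (f-injective : Injective _≡_ _≡_ f) where

  f⁻¹ : Fin n → Fin n
  f⁻¹ a = proj₁ (injective⇒surjective f-injective a)

  inverseʳ : ∀ a → f (f⁻¹ a) ≡ a
  inverseʳ a = proj₂ (injective⇒surjective f-injective a)

  inverseˡ : ∀ i → f⁻¹ (f i) ≡ i
  inverseˡ i = f-injective (inverseʳ (f i))

strictlyIncreasing⇒inflationary : ∀ {m k} (f : Fin m → Fin k) → f Preserves _<_ ⟶ _<_ → ∀ a → a ≤ f a
strictlyIncreasing⇒inflationary f f-mono Fin.zero    = z≤n
strictlyIncreasing⇒inflationary f f-mono (Fin.suc a) = begin-strict
  toℕ a                ≤⟨ strictlyIncreasing⇒inflationary (f ∘ inject₁) (f-mono ∘ inject₁-mono) a ⟩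
  toℕ (f (inject₁ a))  <⟨ f-mono (≤̄⇒inject₁< ℕ.≤-refl) ⟩
  toℕ (f (Fin.suc a))  ∎
  where
  open ℕ.≤-Reasoning
  inject₁-mono : ∀ {i j} → i < j → inject₁ i < inject₁ j
  inject₁-mono {i} {j} = subst₂ ℕ._<_ (sym (toℕ-inject₁ i)) (sym (toℕ-inject₁ j))

module _ {n ℓ} {_≺_ : Rel (Fin n) ℓ} (≺-connex : ∀ {i j} → i ≢ j → i ≺ j ⊎ j ≺ i) where

  embedding-injective : ∀ {f : Fin n → Fin n} → f Preserves _≺_ ⟶ _<_ → Injective _≡_ _≡_ f
  embedding-injective f-mono {i} {j} fi≡fj with i ≟ j
  ... | yes i≡j = i≡j
  ... | no i≢j with ≺-connex i≢j
  ...   | inj₁ i≺j = contradiction fi≡fj (<⇒≢ (f-mono i≺j))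
  ...   | inj₂ j≺i = contradiction (sym fi≡fj) (<⇒≢ (f-mono j≺i))

  private
    embedding-dominates : ∀ {f g : Fin n → Fin n} → f Preserves _≺_ ⟶ _<_ → g Preserves _≺_ ⟶ _<_
                        → ∀ i → g i ≤ f i
    embedding-dominates {f} {g} f-mono g-mono i =
      subst (λ k → g i ≤ f k) (inverseˡ i) (strictlyIncreasing⇒inflationary (f ∘ g⁻¹) f∘g⁻¹-mono (g i))
      where
      open Inverse (embedding-injective g-mono) renaming (f⁻¹ to g⁻¹)
      f∘g⁻¹-mono : (f ∘ g⁻¹) Preserves _<_ ⟶ _<_
      f∘g⁻¹-mono {a} {b} a<b with ≺-connex (λ eq → <⇒≢ a<b (trans (sym (inverseʳ a)) (trans (cong g eq) (inverseʳ b))))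
      ... | inj₁ ≺ = f-mono ≺
      ... | inj₂ ≻ = contradiction (subst₂ _<_ (inverseʳ b) (inverseʳ a) (g-mono ≻)) (<-asym a<b)

  embeddings-agree : ∀ {f g : Fin n → Fin n} → f Preserves _≺_ ⟶ _<_ → g Preserves _≺_ ⟶ _<_ → f ≗ g
  embeddings-agree f-mono g-mono i =
    ≤-antisym (embedding-dominates g-mono f-mono i) (embedding-dominates f-mono g-mono i)

-- Adjacent transpositions and the bubble-sort potential

∑-≤ : ∀ {n} (g : Fin n → ℕ) {c} → (∀ k → g k ℕ.≤ c) → ∑ g ℕ.≤ n * c
∑-≤ {zero}  g bound = z≤n
∑-≤ {suc n} g bound = ℕ.+-mono-≤ (bound Fin.zero) (∑-≤ (g ∘ Fin.suc) (bound ∘ Fin.suc))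

∑-update : ∀ {n} {g g′ : Fin n → ℕ} a → (∀ k → k ≢ a → g k ≡ g′ k) → ∑ g + g′ a ≡ ∑ g′ + g a
∑-update {suc n} {g} {g′} Fin.zero agree = begin
  g 0F + ∑ (g ∘ Fin.suc) + g′ 0F   ≡⟨ cong (λ s → g 0F + s + g′ 0F) (sum-cong-≗ (λ k → agree (Fin.suc k) λ ())) ⟩
  g 0F + ∑ (g′ ∘ Fin.suc) + g′ 0F  ≡⟨ xy∙z≈zy∙x (g 0F) _ (g′ 0F) ⟩
  g′ 0F + ∑ (g′ ∘ Fin.suc) + g 0F  ∎
  where open ≡-Reasoning
∑-update {suc n} {g} {g′} (Fin.suc a) agree = begin
  g 0F + ∑ (g ∘ Fin.suc) + g′ (Fin.suc a)     ≡⟨ ℕ.+-assoc (g 0F) _ _ ⟩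
  g 0F + (∑ (g ∘ Fin.suc) + g′ (Fin.suc a))   ≡⟨ cong₂ _+_ (agree 0F λ ()) (∑-update a agree-suc) ⟩
  g′ 0F + (∑ (g′ ∘ Fin.suc) + g (Fin.suc a))  ≡⟨ ℕ.+-assoc (g′ 0F) _ _ ⟨
  g′ 0F + ∑ (g′ ∘ Fin.suc) + g (Fin.suc a)    ∎
  where
  open ≡-Reasoning
  agree-suc : ∀ k → k ≢ a → g (Fin.suc k) ≡ g′ (Fin.suc k)
  agree-suc k k≢a = agree (Fin.suc k) (k≢a ∘ suc-injective)

∑-update₂ : ∀ {n} {g g′ : Fin n → ℕ} {a b} → a ≢ b → (∀ k → k ≢ a → k ≢ b → g k ≡ g′ k)
          → ∑ g + g′ a + g′ b ≡ ∑ g′ + g a + g b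
∑-update₂ {n} {g} {g′} {a} {b} a≢b agree = begin
  ∑ g + g′ a + g′ b  ≡⟨ cong (λ x → ∑ g + x + g′ b) (updateAt-updates a g) ⟨
  ∑ g + h a + g′ b   ≡⟨ cong (_+ g′ b) (∑-update a (λ k k≢a → sym (updateAt-minimal k a g k≢a))) ⟩
  ∑ h + g a + g′ b   ≡⟨ xy∙z≈xz∙y (∑ h) _ _ ⟩
  ∑ h + g′ b + g a   ≡⟨ cong (_+ g a) (∑-update b h≈g′) ⟩
  ∑ g′ + h b + g a   ≡⟨ cong (λ x → ∑ g′ + x + g a) (updateAt-minimal b a g (a≢b ∘ sym)) ⟩
  ∑ g′ + g b + g a   ≡⟨ xy∙z≈xz∙y (∑ g′) _ _ ⟩
  ∑ g′ + g a + g b   ∎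
  where
  open ≡-Reasoning
  h : Fin n → ℕ
  h = updateAt g a (λ _ → g′ a)
  h≈g′ : ∀ k → k ≢ b → h k ≡ g′ k
  h≈g′ k k≢b with k ≟ a
  ... | yes refl = updateAt-updates k g
  ... | no k≢a   = trans (updateAt-minimal k a g k≢a) (agree k k≢a k≢b)

Adjacent : ∀ {n} → Fin n → Fin n → Set
Adjacent i j = toℕ j ≡ suc (toℕ i)

Adjacent⇒≢ : ∀ {n} {i j : Fin n} → Adjacent i j → i ≢ j
Adjacent⇒≢ adj refl = ℕ.1+n≢n (sym adj)

module _ {n} (i j : Fin n) where

  transpose-matchˡ : transpose i j i ≡ j
  transpose-matchˡ with i ≟ i
  ... | yes _  = refl
  ... | no i≢i = contradiction refl i≢i

  transpose-matchʳ : transpose i j j ≡ i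
  transpose-matchʳ with j ≟ i
  ... | yes j≡i = j≡i
  ... | no _ with j ≟ j
  ...   | yes _  = refl
  ...   | no j≢j = contradiction refl j≢j

  transpose-mismatch : ∀ {k} → k ≢ i → k ≢ j → transpose i j k ≡ k
  transpose-mismatch {k} k≢i k≢j with k ≟ i
  ... | yes k≡i = contradiction k≡i k≢i
  ... | no _ with k ≟ j
  ...   | yes k≡j = contradiction k≡j k≢j
  ...   | no _    = refl

  transpose-injective : Injective _≡_ _≡_ (transpose i j)
  transpose-injective {a} {b} eq = begin
    a                                ≡⟨ transpose-inverse j i ⟨
    transpose j i (transpose i j a)  ≡⟨ cong (transpose j i) eq ⟩
    transpose j i (transpose i j b)  ≡⟨ transpose-inverse j i ⟩
    b                                ∎
    where open ≡-Reasoning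

  transpose-respects : ∀ {A : Set} (g : Fin n → A) → g i ≡ g j → ∀ k → g (transpose i j k) ≡ g k
  transpose-respects g gi≡gj k with k ≟ i
  ... | yes refl = sym gi≡gj
  ... | no _ with k ≟ j
  ...   | yes refl = gi≡gj
  ...   | no _     = refl

weight : ∀ {n} → (Fin n → Fin n) → ℕ
weight f = ∑ (λ k → toℕ k * toℕ (f k))

weight-≤ : ∀ {n} (f : Fin n → Fin n) → weight f ℕ.≤ n * (n * n)
weight-≤ f = ∑-≤ _ (λ k → ℕ.*-mono-≤ (ℕ.<⇒≤ (toℕ<n k)) (ℕ.<⇒≤ (toℕ<n (f k))))

-- The swap raises the weight by exactly toℕ (f i) ∸ toℕ (f j).
weight-transpose : ∀ {n} (f : Fin n → Fin n) {i j} → Adjacent i j → f j < f i → weight f ℕ.< weight (f ∘ transpose i j)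
weight-transpose {n} f {i} {j} adj fj<fi = ℕ.+-cancelʳ-< (c + b) (weight f) (weight fτ) (begin-strict
  weight f + (c + b)                          <⟨ ℕ.+-monoʳ-< (weight f) (ℕ.+-monoʳ-< c fj<fi) ⟩
  weight f + (c + a)                          ≡⟨ spread (weight f) a b ⟨
  weight f + toℕ i * b + toℕ j * a            ≡⟨ exchange ⟩
  weight fτ + toℕ i * a + toℕ j * b           ≡⟨ spread (weight fτ) b a ⟩
  weight fτ + (toℕ i * b + toℕ i * a + b)     ≡⟨ cong (λ t → weight fτ + (t + b)) (ℕ.+-comm (toℕ i * b) _) ⟩
  weight fτ + (c + b)                         ∎)
  where
  open ℕ.≤-Reasoning
  fτ : Fin n → Fin n
  fτ = f ∘ transpose i j
  a b c : ℕ
  a = toℕ (f i)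
  b = toℕ (f j)
  c = toℕ i * a + toℕ i * b
  spread : ∀ w a b → w + toℕ i * b + toℕ j * a ≡ w + (toℕ i * a + toℕ i * b + a)
  spread w a b = spread′ w _ _ a b adj
    where
    lemma : ∀ w p a b → w + p * b + suc p * a ≡ w + (p * a + p * b + a)
    lemma = solve-∀
    spread′ : ∀ w p q a b → q ≡ suc p → w + p * b + q * a ≡ w + (p * a + p * b + a)
    spread′ w p _ a b refl = lemma w p a b
  agree : ∀ k → k ≢ i → k ≢ j → toℕ k * toℕ (f k) ≡ toℕ k * toℕ (fτ k)
  agree k k≢i k≢j = cong (λ l → toℕ k * toℕ (f l)) (sym (transpose-mismatch i j k≢i k≢j))
  exchange : weight f + toℕ i * b + toℕ j * a ≡ weight fτ + toℕ i * a + toℕ j * b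
  exchange = trans (sym (cong₂ (λ k l → weight f + toℕ i * toℕ (f k) + toℕ j * toℕ (f l))
                               (transpose-matchˡ i j) (transpose-matchʳ i j)))
                   (∑-update₂ (Adjacent⇒≢ adj) agree)

-- Parabolic factorization

-- Positions are 0-based, while Set(α) lists 1-based descent positions: the descent between
-- positions i and j = i + 1 is recorded at toℕ j.
DescentsIn : ∀ {m k} → (ℕ → Bool) → (Fin m → Fin k) → Set
DescentsIn cut f = ∀ {i j} → Adjacent i j → f j < f i → T (cut (toℕ j))

ascent : ∀ {m k} {cut} {f : Fin m → Fin k} → DescentsIn cut f → Injective _≡_ _≡_ f
       → ∀ {i j} → Adjacent i j → ¬ T (cut (toℕ j)) → f i < f j
ascent {f = f} f-descents f-injective {i} {j} adj ¬cut with <-cmp (f i) (f j)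
... | tri< fi<fj _ _ = fi<fj
... | tri≈ _ fi≡fj _ = contradiction (f-injective fi≡fj) (Adjacent⇒≢ adj)
... | tri> _ _ fj<fi = contradiction (f-descents adj fj<fi) ¬cut

descentsIn-resp-≗ : ∀ {m k} {cut} {f g : Fin m → Fin k} → f ≗ g → DescentsIn cut f → DescentsIn cut g
descentsIn-resp-≗ f≗g f-descents adj lt = f-descents adj (subst₂ _<_ (sym (f≗g _)) (sym (f≗g _)) lt)

injective-resp-≗ : ∀ {m k} {f g : Fin m → Fin k} → f ≗ g → Injective _≡_ _≡_ f → Injective _≡_ _≡_ g
injective-resp-≗ f≗g f-injective eq = f-injective (trans (f≗g _) (trans eq (sym (f≗g _))))

module Blocks {n : ℕ} (cut : ℕ → Bool) where

  -- block k is the number of cuts in 1 … k, so that the 0-based positions k and k + 1 lie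
  -- in the same block exactly when k + 1 is not a cut.
  block : ℕ → ℕ
  block zero    = zero
  block (suc k) = if cut (suc k) then suc (block k) else block k

  block-≤-suc : ∀ k → block k ℕ.≤ block (suc k)
  block-≤-suc k with cut (suc k)
  ... | true  = ℕ.n≤1+n _
  ... | false = ℕ.≤-refl

  block-mono : ∀ {a b} → a ℕ.≤ b → block a ℕ.≤ block b
  block-mono a≤b = go (ℕ.≤⇒≤′ a≤b)
    where
    go : ∀ {a b} → a ℕ.≤′ b → block a ℕ.≤ block b
    go ℕ.≤′-refl        = ℕ.≤-refl
    go (ℕ.≤′-step a≤′b) = ℕ.≤-trans (go a≤′b) (block-≤-suc _)

  SameBlock : Fin n → Fin n → Set
  SameBlock i j = block (toℕ i) ≡ block (toℕ j)

  sameBlock-between : ∀ {a b c} → a ≤ b → b ≤ c → SameBlock a c → SameBlock a b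
  sameBlock-between {b = b} a≤b b≤c same =
    ℕ.≤-antisym (block-mono a≤b) (subst (block (toℕ b) ℕ.≤_) (sym same) (block-mono b≤c))

  adjacent-sameBlock : ∀ {i j} → Adjacent i j → ¬ T (cut (toℕ j)) → SameBlock i j
  adjacent-sameBlock {i} adj ¬cut rewrite adj with cut (suc (toℕ i))
  ... | true  = contradiction _ ¬cut
  ... | false = refl

  sameBlock-noCut : ∀ {i j} → Adjacent i j → SameBlock i j → ¬ T (cut (toℕ j))
  sameBlock-noCut {i} adj same rewrite adj with cut (suc (toℕ i))
  ... | true  = λ _ → ℕ.1+n≢n (sym same)
  ... | false = λ ()

  ascendsWithinBlock : ∀ {k} {x : Fin n → Fin k} → DescentsIn cut x → Injective _≡_ _≡_ x
                     → ∀ {a b} → a < b → SameBlock a b → x a < x b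
  ascendsWithinBlock {x = x} x-descents x-injective {a} {b} a<b = go _ a (sym (ℕ.m+[n∸m]≡n a<b))
    where
    ascendsAt : ∀ {i j} → Adjacent i j → SameBlock i j → x i < x j
    ascendsAt adj same = ascent {cut = cut} x-descents x-injective adj (sameBlock-noCut adj same)
    go : ∀ d a → toℕ b ≡ suc (toℕ a) + d → SameBlock a b → x a < x b
    go zero    a b≡a+1   same = ascendsAt (trans b≡a+1 (ℕ.+-identityʳ _)) same
    go (suc d) a b≡a+d+2 same = <-trans (ascendsAt adj same-ac) (go d c b≡c+d+1 (trans (sym same-ac) same))
      where
      a<b′ : toℕ a ℕ.< toℕ b
      a<b′ = subst (toℕ a ℕ.<_) (sym b≡a+d+2) (ℕ.m≤m+n _ _)
      c : Fin n
      c = fromℕ< (ℕ.≤-<-trans a<b′ (toℕ<n b))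
      adj : Adjacent a c
      adj = toℕ-fromℕ< _
      same-ac : SameBlock a c
      same-ac = sameBlock-between (subst (toℕ a ℕ.≤_) (sym adj) (ℕ.n≤1+n _)) (subst (ℕ._≤ toℕ b) (sym adj) a<b′) same
      b≡c+d+1 : toℕ b ≡ suc (toℕ c) + d
      b≡c+d+1 = trans b≡a+d+2 (trans (cong suc (ℕ.+-suc (toℕ a) d)) (cong (λ t → suc t + d) (sym adj)))

  PreservesBlocks : (Fin n → Fin n) → Set
  PreservesBlocks y = ∀ i → SameBlock (y i) i

  record Factorization (w : Fin n → Fin n) : Set where
    field
      x y               : Fin n → Fin n
      x-descents        : DescentsIn cut x
      y-injective       : Injective _≡_ _≡_ y
      y-preservesBlocks : PreservesBlocks y
      w≗x∘y             : w ≗ x ∘ y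

  BlockwiseOrder : (Fin n → Fin n) → Rel (Fin n) _
  BlockwiseOrder w i j = block (toℕ i) ℕ.< block (toℕ j) ⊎ (SameBlock i j × w i < w j)

  blockwiseOrder-connex : ∀ {w} → Injective _≡_ _≡_ w → ∀ {i j} → i ≢ j → BlockwiseOrder w i j ⊎ BlockwiseOrder w j i
  blockwiseOrder-connex {w} w-injective {i} {j} i≢j with ℕ.<-cmp (block (toℕ i)) (block (toℕ j))
  ... | tri< lt _ _ = inj₁ (inj₁ lt)
  ... | tri> _ _ gt = inj₂ (inj₁ gt)
  ... | tri≈ _ same _ with <-cmp (w i) (w j)
  ...   | tri< lt _ _ = inj₁ (inj₂ (same , lt))
  ...   | tri≈ _ eq _ = contradiction (w-injective eq) i≢j
  ...   | tri> _ _ gt = inj₂ (inj₂ (sym same , gt))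

  module _ {w : Fin n → Fin n} (w-injective : Injective _≡_ _≡_ w) (F : Factorization w) where
    open Factorization F
    open Inverse y-injective renaming (f⁻¹ to y⁻¹)

    x≗w∘y⁻¹ : x ≗ w ∘ y⁻¹
    x≗w∘y⁻¹ k = trans (cong x (sym (inverseʳ k))) (sym (w≗x∘y (y⁻¹ k)))

    x-injective : Injective _≡_ _≡_ x
    x-injective {a} {b} xa≡xb = begin
      a          ≡⟨ inverseʳ a ⟨
      y (y⁻¹ a)  ≡⟨ cong y (w-injective (trans (sym (x≗w∘y⁻¹ a)) (trans xa≡xb (x≗w∘y⁻¹ b)))) ⟩
      y (y⁻¹ b)  ≡⟨ inverseʳ b ⟩
      b          ∎
      where open ≡-Reasoning

    y-embedding : y Preserves BlockwiseOrder w ⟶ _<_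
    y-embedding {i} {j} (inj₁ block<) with <-cmp (y i) (y j)
    ... | tri< lt _ _ = lt
    ... | tri≈ _ eq _ = contradiction (trans (sym (y-preservesBlocks i)) (trans (cong (block ∘ toℕ) eq) (y-preservesBlocks j)))
                                      (ℕ.<⇒≢ block<)
    ... | tri> _ _ gt = contradiction (subst₂ ℕ._≤_ (y-preservesBlocks j) (y-preservesBlocks i) (block-mono (ℕ.<⇒≤ gt)))
                                      (ℕ.<⇒≱ block<)
    y-embedding {i} {j} (inj₂ (same , w<)) with <-cmp (y i) (y j)
    ... | tri< lt _ _ = lt
    ... | tri≈ _ eq _ = contradiction (trans (w≗x∘y i) (trans (cong x eq) (sym (w≗x∘y j)))) (<⇒≢ w<)
    ... | tri> _ _ gt = contradiction (subst₂ _<_ (sym (w≗x∘y j)) (sym (w≗x∘y i))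
                                        (ascendsWithinBlock x-descents x-injective gt same-y))
                                      (<-asym w<)
      where
      same-y : SameBlock (y j) (y i)
      same-y = trans (y-preservesBlocks j) (trans (sym same) (sym (y-preservesBlocks i)))

  factorization-unique : ∀ {w} → Injective _≡_ _≡_ w → (F G : Factorization w)
                       → Factorization.x F ≗ Factorization.x G × Factorization.y F ≗ Factorization.y G
  factorization-unique {w} w-injective F G = x≗x′ , y≗y′
    where
    open Factorization F
    open Factorization G using () renaming (x to x′; y to y′; w≗x∘y to w≗x′∘y′)
    open Inverse y-injective renaming (f⁻¹ to y⁻¹)
    y≗y′ : y ≗ y′
    y≗y′ = embeddings-agree (blockwiseOrder-connex w-injective) (y-embedding w-injective F) (y-embedding w-injective G)
    x≗x′ : x ≗ x′
    x≗x′ k = begin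
      x k              ≡⟨ x≗w∘y⁻¹ w-injective F k ⟩
      w (y⁻¹ k)        ≡⟨ w≗x′∘y′ (y⁻¹ k) ⟩
      x′ (y′ (y⁻¹ k))  ≡⟨ cong x′ (y≗y′ (y⁻¹ k)) ⟨
      x′ (y (y⁻¹ k))   ≡⟨ cong x′ (inverseʳ k) ⟩
      x′ k             ∎
      where open ≡-Reasoning

  InnerDescent : (Fin n → Fin n) → Fin n → Fin n → Set
  InnerDescent w i j = Adjacent i j × ¬ T (cut (toℕ j)) × w j < w i

  innerDescent? : ∀ w → Dec (∃₂ (InnerDescent w))
  innerDescent? w = any? λ i → any? λ j →
    (toℕ j ℕ.≟ suc (toℕ i)) ×-dec ¬? (T? (cut (toℕ j))) ×-dec (w j Fin.<? w i)

  factorization : ∀ w → Factorization w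
  factorization w = go w (<-wellFounded _)
    where
    potential : (Fin n → Fin n) → ℕ
    potential w = n * (n * n) ℕ.∸ weight w
    go : ∀ w → Acc ℕ._<_ (potential w) → Factorization w
    go w (acc smaller) with innerDescent? w
    ... | no none = record
      { x = w ; y = id ; x-descents = x-descents ; y-injective = id ; y-preservesBlocks = λ _ → refl ; w≗x∘y = λ _ → refl }
      where
      x-descents : DescentsIn cut w
      x-descents adj wj<wi = decidable-stable (T? _) λ ¬cut → none (_ , _ , adj , ¬cut , wj<wi)
    ... | yes (i , j , adj , ¬cut , wj<wi) = record
      { x                 = x
      ; y                 = y ∘ transpose j i
      ; x-descents        = x-descents
      ; y-injective       = transpose-injective j i ∘ y-injective
      ; y-preservesBlocks = λ k → trans (y-preservesBlocks (transpose j i k))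
                                        (transpose-respects j i (block ∘ toℕ) (sym (adjacent-sameBlock adj ¬cut)) k)
      ; w≗x∘y             = λ k → trans (cong w (sym (transpose-inverse i j))) (w≗x∘y (transpose j i k))
      }
      where
      w′ : Fin n → Fin n
      w′ = w ∘ transpose i j
      open Factorization (go w′ (smaller (ℕ.∸-monoʳ-< (weight-transpose w adj wj<wi) (weight-≤ w′))))

  module _ {fine : ℕ → Bool} (cut⊆fine : ∀ {d} → T (cut d) → T (fine d)) where

    ∘-descentsIn : ∀ {x y : Fin n → Fin n} → DescentsIn cut x → Injective _≡_ _≡_ x
                 → Injective _≡_ _≡_ y → DescentsIn fine y → PreservesBlocks y → DescentsIn fine (x ∘ y)
    ∘-descentsIn {x} {y} x-descents x-injective y-injective y-descents y-preservesBlocks {i} {j} adj xyj<xyi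
      with T? (cut (toℕ j))
    ... | yes isCut = cut⊆fine isCut
    ... | no ¬cut = decidable-stable (T? _) λ ¬fine →
      <-asym xyj<xyi (ascendsWithinBlock x-descents x-injective (ascent {cut = fine} y-descents y-injective adj ¬fine) same)
      where
      same : SameBlock (y i) (y j)
      same = trans (y-preservesBlocks i) (trans (adjacent-sameBlock adj ¬cut) (sym (y-preservesBlocks j)))

    factor-descentsIn : ∀ {w} → Injective _≡_ _≡_ w → DescentsIn fine w → (F : Factorization w)
                      → DescentsIn fine (Factorization.y F)
    factor-descentsIn {w} w-injective w-descents F {i} {j} adj yj<yi with T? (cut (toℕ j))
    ... | yes isCut = cut⊆fine isCut
    ... | no ¬cut = w-descents adj (subst₂ _<_ (sym (w≗x∘y j)) (sym (w≗x∘y i))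
                                    (ascendsWithinBlock x-descents (x-injective w-injective F) yj<yi same))
      where
      open Factorization F
      same : SameBlock (y j) (y i)
      same = trans (y-preservesBlocks j) (trans (sym (adjacent-sameBlock adj ¬cut)) (sym (y-preservesBlocks i)))

memᵇ⇒∈ : ∀ {x} xs → T (memᵇ x xs) → x ∈ xs
memᵇ⇒∈ {x} (y ∷ ys) x∈ with x ≡ᵇ y in x≡ᵇy
... | true  = here (ℕ.≡ᵇ⇒≡ x y (subst T (sym x≡ᵇy) tt))
... | false = there (memᵇ⇒∈ ys x∈)

∈⇒memᵇ : ∀ {x xs} → x ∈ xs → T (memᵇ x xs)
∈⇒memᵇ {x} (here refl) with x ≡ᵇ x | ℕ.≡⇒≡ᵇ x x refl
... | true | _ = tt
∈⇒memᵇ {x} {y ∷ ys} (there x∈ys) with x ≡ᵇ y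
... | true  = tt
... | false = ∈⇒memᵇ x∈ys

toℕs : ∀ {m k} → Vec (Fin m) k → List ℕ
toℕs v = map toℕ (toList v)

lookup-∈ : ∀ {A : Set} {k a} (xs : Vec A k) → a ∈ toList xs → ∃ λ i → lookup xs i ≡ a
lookup-∈ (x Vec.∷ xs) (here refl)  = Fin.zero , refl
lookup-∈ (x Vec.∷ xs) (there a∈xs) with i , xsᵢ≡a ← lookup-∈ xs a∈xs = Fin.suc i , xsᵢ≡a

memᵇ-toℕs⁻ : ∀ {m k} {a : Fin m} (xs : Vec (Fin m) k) → T (memᵇ (toℕ a) (toℕs xs)) → ∃ λ i → lookup xs i ≡ a
memᵇ-toℕs⁻ xs a∈ with b , b∈xs , a≡b ← ∈-map⁻ toℕ (memᵇ⇒∈ (toℕs xs) a∈) with i , xsᵢ≡b ← lookup-∈ xs b∈xs =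
  i , trans xsᵢ≡b (sym (toℕ-injective a≡b))

memᵇ-toℕs⁺ : ∀ {m k} (xs : Vec (Fin m) k) i → T (memᵇ (toℕ (lookup xs i)) (toℕs xs))
memᵇ-toℕs⁺ xs i = ∈⇒memᵇ (∈-map⁺ toℕ (∈-toList⁺ (∈-lookup i xs)))

T-not-∧⁻ : ∀ {b c} → T ((if b then false else true) ∧ c) → ¬ T b × T c
T-not-∧⁻ {false} t = (λ ()) , t

T-not-∧⁺ : ∀ {b c} → ¬ T b → T c → T ((if b then false else true) ∧ c)
T-not-∧⁺ {false} _  t = t
T-not-∧⁺ {true}  ¬t _ = ¬t tt

distinctᵇ⇒injective : ∀ {m k} (v : Vec (Fin m) k) → T (distinctᵇ (toℕs v)) → Injective _≡_ _≡_ (lookup v)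
distinctᵇ⇒injective (x Vec.∷ xs) distinct {Fin.zero}  {Fin.zero}  _  = refl
distinctᵇ⇒injective (x Vec.∷ xs) distinct {Fin.zero}  {Fin.suc j} eq =
  contradiction (subst (λ a → T (memᵇ (toℕ a) (toℕs xs))) (sym eq) (memᵇ-toℕs⁺ xs j)) (proj₁ (T-not-∧⁻ distinct))
distinctᵇ⇒injective (x Vec.∷ xs) distinct {Fin.suc i} {Fin.zero}  eq =
  contradiction (subst (λ a → T (memᵇ (toℕ a) (toℕs xs))) eq (memᵇ-toℕs⁺ xs i)) (proj₁ (T-not-∧⁻ distinct))
distinctᵇ⇒injective (x Vec.∷ xs) distinct {Fin.suc i} {Fin.suc j} eq =
  cong Fin.suc (distinctᵇ⇒injective xs (proj₂ (T-not-∧⁻ {memᵇ (toℕ x) (toℕs xs)} distinct)) eq)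

injective⇒distinctᵇ : ∀ {m k} (v : Vec (Fin m) k) → Injective _≡_ _≡_ (lookup v) → T (distinctᵇ (toℕs v))
injective⇒distinctᵇ Vec.[]         _           = tt
injective⇒distinctᵇ (x Vec.∷ xs) v-injective = T-not-∧⁺ x∉xs (injective⇒distinctᵇ xs (suc-injective ∘ v-injective))
  where
  x∉xs : ¬ T (memᵇ (toℕ x) (toℕs xs))
  x∉xs x∈xs with i , xsᵢ≡x ← memᵇ-toℕs⁻ xs x∈xs = contradiction (v-injective {Fin.suc i} {Fin.zero} xsᵢ≡x) λ ()

T-allᵇ⁻ : ∀ {A : Set} (p : A → Bool) xs → T (allᵇ p xs) → All (T ∘ p) xs
T-allᵇ⁻ p []       _   = All.[]
T-allᵇ⁻ p (x ∷ xs) all with px , pxs ← Equivalence.to T-∧ all = px All.∷ T-allᵇ⁻ p xs pxs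

T-allᵇ⁺ : ∀ {A : Set} (p : A → Bool) {xs} → All (T ∘ p) xs → T (allᵇ p xs)
T-allᵇ⁺ p All.[]         = tt
T-allᵇ⁺ p (px All.∷ pxs) = Equivalence.from T-∧ (px , T-allᵇ⁺ p pxs)

module _ {P : ℕ → Set} where

  private
    firstDescent : ∀ {b o} → All P (if b then o ∷ [] else []) → T b → P o
    firstDescent {true} (po All.∷ All.[]) _ = po

  desAux⁻ : ∀ {m k} o (v : Vec (Fin m) k) → All P (desAux o (toℕs v))
          → ∀ {i j} → Adjacent i j → lookup v j < lookup v i → P (o + toℕ i)
  desAux⁻ o (x Vec.∷ y Vec.∷ r) all {Fin.zero}  {Fin.suc Fin.zero} _ y<x =
    subst P (sym (ℕ.+-identityʳ o)) (firstDescent (Allₚ.++⁻ˡ _ all) (ℕ.<⇒<ᵇ y<x))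
  desAux⁻ o (x Vec.∷ y Vec.∷ r) all {Fin.suc i} {Fin.suc j} adj lt =
    subst P (sym (ℕ.+-suc o (toℕ i))) (desAux⁻ (suc o) (y Vec.∷ r) (Allₚ.++⁻ʳ _ all) (ℕ.suc-injective adj) lt)
  desAux⁻ o (x Vec.∷ y Vec.∷ r) all {Fin.zero} {Fin.suc (Fin.suc j)} () lt
  desAux⁻ o (x Vec.∷ Vec.[])    all {Fin.zero} {Fin.zero}             () lt

  desAux⁺ : ∀ {m k} o (v : Vec (Fin m) k)
          → (∀ {i j} → Adjacent i j → lookup v j < lookup v i → P (o + toℕ i)) → All P (desAux o (toℕs v))
  desAux⁺ o Vec.[]                descents = All.[]
  desAux⁺ o (x Vec.∷ Vec.[])      descents = All.[]
  desAux⁺ o (x Vec.∷ y Vec.∷ r) descents = Allₚ.++⁺ first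
    (desAux⁺ (suc o) (y Vec.∷ r) λ adj lt → subst P (ℕ.+-suc o _) (descents (cong suc adj) lt))
    where
    first : All P (if toℕ y <ᵇ toℕ x then o ∷ [] else [])
    first with toℕ y <ᵇ toℕ x in y<ᵇx
    ... | true  = subst P (ℕ.+-identityʳ o) (descents {Fin.zero} {Fin.suc Fin.zero} refl (ℕ.<ᵇ⇒< _ _ (subst T (sym y<ᵇx) tt)))
                  All.∷ All.[]
    ... | false = All.[]

module _ {n} (cut : ℕ → Bool) (w : Word n) where

  allᵇ-Des⁻ : T (allᵇ cut (Des w)) → DescentsIn cut (lookup w)
  allᵇ-Des⁻ all adj lt = subst (T ∘ cut) (sym adj) (desAux⁻ 1 w (T-allᵇ⁻ cut _ all) adj lt)

  allᵇ-Des⁺ : DescentsIn cut (lookup w) → T (allᵇ cut (Des w))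
  allᵇ-Des⁺ descents = T-allᵇ⁺ cut (desAux⁺ 1 w λ adj lt → subst (T ∘ cut) adj (descents adj lt))

concatMap-map≡cartesianProductWith : ∀ {A B C : Set} (f : A → B → C) xs ys
                                   → concatMap (λ x → map (f x) ys) xs ≡ cartesianProductWith f xs ys
concatMap-map≡cartesianProductWith f []       ys = refl
concatMap-map≡cartesianProductWith f (x ∷ xs) ys = cong (map (f x) ys ++_) (concatMap-map≡cartesianProductWith f xs ys)

map-uncurry-cartesianProduct : ∀ {A B C : Set} (f : A → B → C) xs ys
                             → map (uncurry f) (cartesianProduct xs ys) ≡ cartesianProductWith f xs ys
map-uncurry-cartesianProduct f []       ys = refl
map-uncurry-cartesianProduct f (x ∷ xs) ys = trans (List.map-++ (uncurry f) (map (x ,_) ys) _)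
  (cong₂ _++_ (sym (List.map-∘ ys)) (map-uncurry-cartesianProduct f xs ys))

∈-allVecs : ∀ k m (v : Vec (Fin m) k) → v ∈ allVecs k m
∈-allVecs zero    m Vec.[]       = here refl
∈-allVecs (suc k) m (i Vec.∷ v) = subst (_ ∈_) (sym (concatMap-map≡cartesianProductWith Vec._∷_ (allFin m) _))
  (∈-cartesianProductWith⁺ Vec._∷_ (∈-allFin i) (∈-allVecs k m v))

allVecs-unique : ∀ k m → Unique (allVecs k m)
allVecs-unique zero    m = All.[] AllPairs.∷ AllPairs.[]
allVecs-unique (suc k) m = subst Unique (sym (concatMap-map≡cartesianProductWith Vec._∷_ (allFin m) _))
  (Uniqueₚ.cartesianProductWith⁺ Vec._∷_ Vec.∷-injective (Uniqueₚ.allFin⁺ m) (allVecs-unique k m))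

cuts : List ℕ → ℕ → Bool
cuts α d = memᵇ d (setOf α)

module _ {n : ℕ} where

  -- Definitionally equal to GroupAlgebra.compose, which is only available under a ring.
  _⊙_ : Word n → Word n → Word n
  w ⊙ v = tabulate (lookup w ∘ lookup v)

  lookup-⊙ : ∀ w v → lookup (w ⊙ v) ≗ lookup w ∘ lookup v
  lookup-⊙ w v = Vec.lookup∘tabulate _

  ⊙-assoc : ∀ x y z → (x ⊙ y) ⊙ z ≡ x ⊙ (y ⊙ z)
  ⊙-assoc x y z = Vec.tabulate-cong λ i → trans (lookup-⊙ x y (lookup z i)) (cong (lookup x) (sym (lookup-⊙ y z i)))

  tabulate-≗ : ∀ {f} {w : Word n} → f ≗ lookup w → tabulate f ≡ w
  tabulate-≗ {w = w} f≗w = trans (Vec.tabulate-cong f≗w) (Vec.tabulate∘lookup w)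

  IsPerm-⊙ : ∀ {v w : Word n} → IsPerm v → IsPerm w → IsPerm (v ⊙ w)
  IsPerm-⊙ {v} {w} v-perm w-perm = injective⇒distinctᵇ (v ⊙ w)
    (injective-resp-≗ (λ i → sym (lookup-⊙ v w i)) (distinctᵇ⇒injective w w-perm ∘ distinctᵇ⇒injective v v-perm))

  ∈-Sn⁺ : ∀ {w : Word n} → Injective _≡_ _≡_ (lookup w) → w ∈ Sn n
  ∈-Sn⁺ {w} w-injective = ∈-filter⁺ (T? ∘ isPermᵇ) (∈-allVecs n n w) (injective⇒distinctᵇ w w-injective)

  ∈-Sn⁻ : ∀ {w : Word n} → w ∈ Sn n → Injective _≡_ _≡_ (lookup w)
  ∈-Sn⁻ {w} w∈Sn = distinctᵇ⇒injective w (proj₂ (∈-filter⁻ (T? ∘ isPermᵇ) {xs = allVecs n n} w∈Sn))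

  Sn-unique : Unique (Sn n)
  Sn-unique = Uniqueₚ.filter⁺ (T? ∘ isPermᵇ) (allVecs-unique n n)

  -- B α unfolds to the sum of 1# · w over descentClass α.
  descentClass : List ℕ → List (Word n)
  descentClass α = filterᵇ (desInSetᵇ α) (Sn n)

  ∈-descentClass⁺ : ∀ α {w} → Injective _≡_ _≡_ (lookup w) → DescentsIn (cuts α) (lookup w) → w ∈ descentClass α
  ∈-descentClass⁺ α {w} w-injective w-descents =
    ∈-filter⁺ (T? ∘ desInSetᵇ α) (∈-Sn⁺ w-injective) (allᵇ-Des⁺ (cuts α) w w-descents)

  ∈-descentClass⁻ : ∀ α {w} → w ∈ descentClass α → Injective _≡_ _≡_ (lookup w) × DescentsIn (cuts α) (lookup w)
  ∈-descentClass⁻ α {w} w∈ with w∈Sn , w-descents ← ∈-filter⁻ (T? ∘ desInSetᵇ α) {xs = Sn n} w∈ =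
    ∈-Sn⁻ w∈Sn , allᵇ-Des⁻ (cuts α) w w-descents

  descentClass-unique : ∀ α → Unique (descentClass α)
  descentClass-unique α = Uniqueₚ.filter⁺ (T? ∘ desInSetᵇ α) Sn-unique

module Parabolic {n : ℕ} {β γ : List ℕ} (γ⊆β : ∀ {d} → T (cuts γ d) → T (cuts β d)) where

  open Blocks {n} (cuts γ)

  preservesBlocks? : ∀ y → Dec (PreservesBlocks y)
  preservesBlocks? y = all? λ i → block (toℕ (y i)) ℕ.≟ block (toℕ i)

  withinBlocks : List (Word n)
  withinBlocks = filter (preservesBlocks? ∘ lookup) (descentClass β)

  ∈-withinBlocks⁻ : ∀ {y} → y ∈ withinBlocks
                  → Injective _≡_ _≡_ (lookup y) × DescentsIn (cuts β) (lookup y) × PreservesBlocks (lookup y)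
  ∈-withinBlocks⁻ y∈ with y∈Xβ , y-preservesBlocks ← ∈-filter⁻ (preservesBlocks? ∘ lookup) {xs = descentClass β} y∈
                     with y-injective , y-descents ← ∈-descentClass⁻ β y∈Xβ = y-injective , y-descents , y-preservesBlocks

  factor : Word n → Word n × Word n
  factor w = tabulate x , tabulate y
    where open Factorization (factorization (lookup w))

  ⊙-factor : ∀ w → uncurry _⊙_ (factor w) ≡ w
  ⊙-factor w = tabulate-≗ λ i → begin
    lookup (tabulate x) (lookup (tabulate y) i)  ≡⟨ Vec.lookup∘tabulate x _ ⟩
    x (lookup (tabulate y) i)                    ≡⟨ cong x (Vec.lookup∘tabulate y i) ⟩
    x (y i)                                      ≡⟨ w≗x∘y i ⟨
    lookup w i                                   ∎
    where
    open Factorization (factorization (lookup w))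
    open ≡-Reasoning

  factor-injective : ∀ {w w′} → factor w ≡ factor w′ → w ≡ w′
  factor-injective {w} {w′} eq = trans (sym (⊙-factor w)) (trans (cong (uncurry _⊙_) eq) (⊙-factor w′))

  factor-∈ : ∀ {w} → w ∈ descentClass β → factor w ∈ cartesianProduct (descentClass γ) withinBlocks
  factor-∈ {w} w∈ = ∈-cartesianProduct⁺
    (∈-descentClass⁺ γ (injective-resp-≗ x≗ (x-injective w-injective F)) (descentsIn-resp-≗ {cut = cuts γ} x≗ x-descents))
    (∈-filter⁺ (preservesBlocks? ∘ lookup)
      (∈-descentClass⁺ β (injective-resp-≗ y≗ y-injective)
                         (descentsIn-resp-≗ {cut = cuts β} y≗ (factor-descentsIn γ⊆β w-injective w-descents F)))
      λ i → trans (cong (block ∘ toℕ) (Vec.lookup∘tabulate y i)) (y-preservesBlocks i))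
    where
    F : Factorization (lookup w)
    F = factorization (lookup w)
    open Factorization F
    w-injective : Injective _≡_ _≡_ (lookup w)
    w-injective = proj₁ (∈-descentClass⁻ β w∈)
    w-descents : DescentsIn (cuts β) (lookup w)
    w-descents = proj₂ (∈-descentClass⁻ β w∈)
    x≗ : x ≗ lookup (tabulate x)
    x≗ i = sym (Vec.lookup∘tabulate x i)
    y≗ : y ≗ lookup (tabulate y)
    y≗ i = sym (Vec.lookup∘tabulate y i)

  ∈-factors : ∀ {x y} → x ∈ descentClass γ → y ∈ withinBlocks → (x , y) ∈ map factor (descentClass β)
  ∈-factors {x} {y} x∈ y∈ = subst (_∈ map factor (descentClass β)) factor-x⊙y (∈-map⁺ factor x⊙y∈)
    where
    x-injective′ : Injective _≡_ _≡_ (lookup x)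
    x-injective′ = proj₁ (∈-descentClass⁻ γ x∈)
    x-descents′ : DescentsIn (cuts γ) (lookup x)
    x-descents′ = proj₂ (∈-descentClass⁻ γ x∈)
    y-injective′ : Injective _≡_ _≡_ (lookup y)
    y-injective′ = proj₁ (∈-withinBlocks⁻ y∈)
    y-descents′ : DescentsIn (cuts β) (lookup y)
    y-descents′ = proj₁ (proj₂ (∈-withinBlocks⁻ y∈))
    y-preservesBlocks′ : PreservesBlocks (lookup y)
    y-preservesBlocks′ = proj₂ (proj₂ (∈-withinBlocks⁻ y∈))
    x⊙y-injective : Injective _≡_ _≡_ (lookup (x ⊙ y))
    x⊙y-injective = injective-resp-≗ (λ i → sym (lookup-⊙ x y i)) (y-injective′ ∘ x-injective′)
    x⊙y∈ : x ⊙ y ∈ descentClass β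
    x⊙y∈ = ∈-descentClass⁺ β x⊙y-injective (descentsIn-resp-≗ {cut = cuts β} (λ i → sym (lookup-⊙ x y i))
      (∘-descentsIn γ⊆β x-descents′ x-injective′ y-injective′ y-descents′ y-preservesBlocks′))
    G : Factorization (lookup (x ⊙ y))
    G = record { x = lookup x ; y = lookup y ; x-descents = x-descents′ ; y-injective = y-injective′
               ; y-preservesBlocks = y-preservesBlocks′ ; w≗x∘y = lookup-⊙ x y }
    factor-x⊙y : factor (x ⊙ y) ≡ (x , y)
    factor-x⊙y with x≗ , y≗ ← factorization-unique x⊙y-injective (factorization (lookup (x ⊙ y))) G =
      cong₂ _,_ (tabulate-≗ x≗) (tabulate-≗ y≗)

  factors-↭ : map factor (descentClass β) ↭ cartesianProduct (descentClass γ) withinBlocks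
  factors-↭ = ∼bag⇒↭ (unique∧set⇒bag
    (Uniqueₚ.map⁺ factor-injective (descentClass-unique β))
    (Uniqueₚ.cartesianProduct⁺ (descentClass-unique γ) (Uniqueₚ.filter⁺ (preservesBlocks? ∘ lookup) (descentClass-unique β)))
    (mk⇔ to from))
    where
    to : ∀ {p} → p ∈ map factor (descentClass β) → p ∈ cartesianProduct (descentClass γ) withinBlocks
    to p∈ with w , w∈ , refl ← ∈-map⁻ factor p∈ = factor-∈ w∈
    from : ∀ {p} → p ∈ cartesianProduct (descentClass γ) withinBlocks → p ∈ map factor (descentClass β)
    from {x , y} p∈ with x∈ , y∈ ← ∈-cartesianProduct⁻ (descentClass γ) withinBlocks p∈ = ∈-factors x∈ y∈

  descentClass-↭ : descentClass β ↭ cartesianProductWith _⊙_ (descentClass γ) withinBlocks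
  descentClass-↭ = subst₂ _↭_ ⊙∘factor≡id (map-uncurry-cartesianProduct _⊙_ (descentClass γ) withinBlocks)
                              (↭.map⁺ (uncurry _⊙_) factors-↭)
    where
    ⊙∘factor≡id : map (uncurry _⊙_) (map factor (descentClass β)) ≡ descentClass β
    ⊙∘factor≡id = trans (sym (List.map-∘ (descentClass β))) (trans (List.map-cong ⊙-factor _) (List.map-id _))

concatMap-concatMap : ∀ {a b c} {A : Set a} {B : Set b} {C : Set c} (g : B → List C) (f : A → List B) xs
                    → concatMap g (concatMap f xs) ≡ concatMap (concatMap g ∘ f) xs
concatMap-concatMap g f []       = refl
concatMap-concatMap g f (x ∷ xs) =
  trans (List.concatMap-++ g (f x) _) (cong (concatMap g (f x) ++_) (concatMap-concatMap g f xs))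

concatMap-↭ : ∀ {a b} {A : Set a} {B : Set b} (f : A → List B) {xs ys} → xs ↭ ys → concatMap f xs ↭ concatMap f ys
concatMap-↭ f ↭.refl         = ↭.refl
concatMap-↭ f (↭.prep x p)   = ↭.++⁺ˡ (f x) (concatMap-↭ f p)
concatMap-↭ f (↭.swap x y p) = ↭.trans (↭.++⁺ˡ (f x) (↭.++⁺ˡ (f y) (concatMap-↭ f p))) (↭.shifts (f x) (f y))
concatMap-↭ f (↭.trans p q)  = ↭.trans (concatMap-↭ f p) (concatMap-↭ f q)

module GroupAlgebraProperties {c ℓ} (R : CommutativeRing c ℓ) (n : ℕ) where

  private module R = CommutativeRing R
  open GroupAlgebra R n
  open CommutativeSemigroupProperties R.+-commutativeSemigroup using (x∙yz≈y∙xz)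

  termSetoid : Setoid c ℓ
  termSetoid = ×-setoid R.setoid (≡.setoid (Word n))

  open Setoid termSetoid using () renaming (_≈_ to _∼_)
  open import Data.List.Relation.Binary.Equality.Setoid termSetoid
    using (_≋_; ≋-setoid; ≋-sym; ≋-trans; ++⁺) renaming ([] to []≋; _∷_ to _∷≋_)

  unit : Word n → R.Carrier × Word n
  unit w = R.1# , w

  _⊗_ : R.Carrier × Word n → R.Carrier × Word n → R.Carrier × Word n
  (a , v) ⊗ (b , w) = a R.* b , v ⊙ w

  coeff-≋ : ∀ {x y} → x ≋ y → x ≈A y
  coeff-≋ []≋                     u = R.refl
  coeff-≋ ((a≈b , refl) ∷≋ x≋y) u = R.+-cong (select a≈b) (coeff-≋ x≋y u)
    where
    select : ∀ {b a a′} → a R.≈ a′ → (if b then a else R.0#) R.≈ (if b then a′ else R.0#)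
    select {true}  a≈a′ = a≈a′
    select {false} _    = R.refl

  coeff-↭ : ∀ {x y} → x ↭ y → x ≈A y
  coeff-↭ ↭.refl         u = R.refl
  coeff-↭ (↭.prep t p)   u = R.+-congˡ (coeff-↭ p u)
  coeff-↭ (↭.swap s t p) u = R.trans (R.+-congˡ (R.+-congˡ (coeff-↭ p u))) (x∙yz≈y∙xz _ _ _)
  coeff-↭ (↭.trans p q)  u = R.trans (coeff-↭ p u) (coeff-↭ q u)

  map-≋ : ∀ {a} {A : Set a} {f g : A → R.Carrier × Word n} → (∀ t → f t ∼ g t) → ∀ xs → map f xs ≋ map g xs
  map-≋ f∼g []       = []≋
  map-≋ f∼g (t ∷ xs) = f∼g t ∷≋ map-≋ f∼g xs

  concatMap-≋ : ∀ {a} {A : Set a} {f g : A → Elt} → (∀ t → f t ≋ g t) → ∀ xs → concatMap f xs ≋ concatMap g xs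
  concatMap-≋ f≋g []       = []≋
  concatMap-≋ f≋g (t ∷ xs) = ++⁺ (f≋g t) (concatMap-≋ f≋g xs)

  ⊗-assoc : ∀ s t r → ((s ⊗ t) ⊗ r) ∼ (s ⊗ (t ⊗ r))
  ⊗-assoc (a , u) (b , v) (c , w) = R.*-assoc a b c , ⊙-assoc u v w

  ·-assoc : ∀ x y z → (x · y) · z ≋ x · (y · z)
  ·-assoc x y z = begin
    (x · y) · z
      ≡⟨ concatMap-concatMap (λ p → map (p ⊗_) z) (λ s → map (s ⊗_) y) x ⟩
    concatMap (λ s → concatMap (λ p → map (p ⊗_) z) (map (s ⊗_) y)) x
      ≡⟨ List.concatMap-cong (λ s → List.concatMap-map (λ p → map (p ⊗_) z) (s ⊗_) y) x ⟩
    concatMap (λ s → concatMap (λ t → map ((s ⊗ t) ⊗_) z) y) x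
      ≈⟨ concatMap-≋ (λ s → concatMap-≋ (λ t → map-≋ (⊗-assoc s t) z) y) x ⟩
    concatMap (λ s → concatMap (λ t → map (λ r → s ⊗ (t ⊗ r)) z) y) x
      ≡⟨ List.concatMap-cong (λ s → List.concatMap-cong (λ t → List.map-∘ z) y) x ⟩
    concatMap (λ s → concatMap (λ t → map (s ⊗_) (map (t ⊗_) z)) y) x
      ≡⟨ List.concatMap-cong (λ s → List.map-concatMap (s ⊗_) (λ t → map (t ⊗_) z) y) x ⟨
    x · (y · z) ∎
    where open import Relation.Binary.Reasoning.Setoid ≋-setoid

  ·-congʳ-≋ : ∀ {x x′} → x ≋ x′ → ∀ a → x · a ≋ x′ · a
  ·-congʳ-≋ []≋                      a = []≋
  ·-congʳ-≋ ((c≈c′ , refl) ∷≋ x≋x′) a = ++⁺ (map-≋ (λ t → R.*-congʳ c≈c′ , refl) a) (·-congʳ-≋ x≋x′ a)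

  ·-congʳ-↭ : ∀ {x x′} → x ↭ x′ → ∀ a → x · a ↭ x′ · a
  ·-congʳ-↭ x↭x′ a = concatMap-↭ (λ s → map (s ⊗_) a) x↭x′

  unitSum-· : ∀ xs ys → map unit xs · map unit ys ≋ map unit (cartesianProductWith _⊙_ xs ys)
  unitSum-· xs ys = begin
    map unit xs · map unit ys
      ≡⟨ List.concatMap-map (λ s → map (s ⊗_) (map unit ys)) unit xs ⟩
    concatMap (λ x → map (unit x ⊗_) (map unit ys)) xs
      ≡⟨ List.concatMap-cong (λ x → List.map-∘ ys) xs ⟨
    concatMap (λ x → map (λ y → unit x ⊗ unit y) ys) xs
      ≈⟨ concatMap-≋ (λ x → map-≋ (λ y → R.*-identityˡ R.1# , refl) ys) xs ⟩
    concatMap (λ x → map (unit ∘ (x ⊙_)) ys) xs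
      ≡⟨ List.concatMap-cong (λ x → List.map-∘ ys) xs ⟩
    concatMap (λ x → map unit (map (x ⊙_) ys)) xs
      ≡⟨ List.map-concatMap unit (λ x → map (x ⊙_) ys) xs ⟨
    map unit (concatMap (λ x → map (x ⊙_) ys) xs)
      ≡⟨ cong (map unit) (concatMap-map≡cartesianProductWith _⊙_ xs ys) ⟩
    map unit (cartesianProductWith _⊙_ xs ys) ∎
    where open import Relation.Binary.Reasoning.Setoid ≋-setoid

  unitSum-factor : ∀ {xs} ys zs → xs ↭ cartesianProductWith _⊙_ ys zs
                 → ∀ a → (map unit xs · a) ≈A (map unit ys · (map unit zs · a))
  unitSum-factor ys zs xs↭ys⊙zs a u = R.trans
    (coeff-↭ (·-congʳ-↭ (↭.map⁺ unit xs↭ys⊙zs) a) u)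
    (coeff-≋ (≋-trans (·-congʳ-≋ (≋-sym (unitSum-· ys zs)) a) (·-assoc (map unit ys) (map unit zs) a)) u)

  InA-· : ∀ {x y} → InA x → InA y → InA (x · y)
  InA-· x∈𝒜 y∈𝒜 = Allₚ.concat⁺ (Allₚ.map⁺ (All.map (λ {s} s-perm →
    Allₚ.map⁺ (All.map (λ {t} → IsPerm-⊙ {v = proj₂ s} {w = proj₂ t} s-perm) y∈𝒜)) x∈𝒜))

-- Refinement

setOf-++ : ∀ a p b q → sum (a ∷ p) ∈ setOf ((a ∷ p) ++ (b ∷ q))
setOf-++ a []       b q = here (ℕ.+-identityʳ a)
setOf-++ a (a′ ∷ p) b q = there (∈-map⁺ (a +_) (setOf-++ a′ p b q))

setOf-++-shift : ∀ a p q {d} → d ∈ setOf q → sum (a ∷ p) + d ∈ setOf ((a ∷ p) ++ q)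
setOf-++-shift a []       (b ∷ q) d∈ =
  subst (_∈ setOf (a ∷ b ∷ q)) (cong (_+ _) (sym (ℕ.+-identityʳ a))) (there (∈-map⁺ (a +_) d∈))
setOf-++-shift a (a′ ∷ p) q {d} d∈ =
  subst (_∈ setOf (a ∷ a′ ∷ p ++ q)) (sym (ℕ.+-assoc a (sum (a′ ∷ p)) d)) (there (∈-map⁺ (a +_) (setOf-++-shift a′ p q d∈)))

setOf-concat : ∀ {pieces : List (List ℕ)} → All (λ p → 0 ℕ.< sum p) pieces
             → ∀ {d} → d ∈ setOf (map sum pieces) → d ∈ setOf (concat pieces)
setOf-concat {(a ∷ p) ∷ (b ∷ p′) ∷ ps} _                   (here refl) = setOf-++ a p b (p′ ++ concat ps)
setOf-concat {(a ∷ p) ∷ p′ ∷ ps}       (_ All.∷ positive) (there d∈)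
  with e , e∈ , refl ← ∈-map⁻ (sum (a ∷ p) +_) d∈ = setOf-++-shift a p (concat (p′ ∷ ps)) (setOf-concat positive e∈)
setOf-concat {[] ∷ _ ∷ _} (() All.∷ _) _
setOf-concat {_ ∷ [] ∷ _} (_ All.∷ () All.∷ _) (here _)

refines⇒setOf⊆ : ∀ {β γ} → All (0 ℕ.<_) γ → Refines β γ → ∀ {d} → d ∈ setOf γ → d ∈ setOf β
refines⇒setOf⊆ γ-positive (pieces , refl , refl) = setOf-concat (Allₚ.map⁻ γ-positive)

lemma2p5 : {c ℓ : Level} (R : CommutativeRing c ℓ) (n : ℕ) (β γ : List ℕ)
           → IsComposition n β → IsComposition n γ → Refines β γ
           → ∀ x → GroupAlgebra.InBA R n β x
           → GroupAlgebra.InBA R n γ x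
lemma2p5 R n β γ _ (γ-positive , _) β-refines-γ x (a , a∈𝒜 , x≈Bβ·a) =
  map unit withinBlocks · a , InA-· withinBlocks∈𝒜 a∈𝒜 , λ u →
    CommutativeRing.trans R (x≈Bβ·a u) (unitSum-factor (descentClass γ) withinBlocks descentClass-↭ a u)
  where
  open GroupAlgebra R n
  open GroupAlgebraProperties R n
  open Parabolic {n} {β} {γ} (∈⇒memᵇ ∘ refines⇒setOf⊆ γ-positive β-refines-γ ∘ memᵇ⇒∈ _)
  withinBlocks∈𝒜 : InA (map unit withinBlocks)
  withinBlocks∈𝒜 = Allₚ.map⁺ (All.tabulate λ {y} y∈ → injective⇒distinctᵇ y (proj₁ (∈-withinBlocks⁻ y∈)))
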